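{- For any non-trivial finite simple bipartite graph $G$, the graph $D_{\Gamma(G)+1}(G)$ is connected.
   Context: A graph is non-trivial if it has more than one vertex. A set $S \subseteq V(G)$ is a dominating set of $G$ if every vertex of $V(G)\setminus S$ is adjacent to a vertex of $S$; it is minimal if no proper subset is a dominating set. $\Gamma(G)$ is the maximum cardinality of a minimal dominating set of $G$. For an integer $k$ at least the minimum cardinality of a dominating set of $G$, the $k$-dominating graph $D_k(G)$ is the graph whose vertices are the dominating sets of $G$ of cardinality at most $k$, two such sets $A,B$ being adjacent if and only if their symmetric difference $(A\setminus B)\cup(B\setminus A)$ consists of exactly one vertex of $G$. -}

module Defs where

open import Data.Nat using (ℕ; _≤_; _+_)
open import Data.Fin using (Fin)
open import Data.Fin.Subset using (Subset; _∈_; _∉_; _⊂_; ∣_∣; _∪_; _─_; ⁅_⁆)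
open import Data.Bool using (Bool)
open import Data.Product using (Σ; ∃; _×_)
open import Relation.Nullary using (¬_)
open import Relation.Binary.PropositionalEquality using (_≡_; _≢_)
open import Relation.Binary using (Decidable)

record Graph (n : ℕ) : Set₁ where
  field
    Adj    : Fin n → Fin n → Set
    adj?   : Decidable Adj
    sym    : ∀ {u v} → Adj u v → Adj v u
    irrefl : ∀ {u} → ¬ Adj u u
open Graph public

Bipartite : ∀ {n} → Graph n → Set
Bipartite {n} G = Σ (Fin n → Bool) λ c → ∀ u v → Adj G u v → c u ≢ c v

Dominating : ∀ {n} → Graph n → Subset n → Set
Dominating {n} G S = ∀ (v : Fin n) → v ∉ S → ∃ λ u → u ∈ S × Adj G v u

MinimalDominating : ∀ {n} → Graph n → Subset n → Set
MinimalDominating {n} G S = Dominating G S × (∀ (T : Subset n) → T ⊂ S → ¬ Dominating G T)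

IsUpperDomination : ∀ {n} → Graph n → ℕ → Set
IsUpperDomination {n} G m =
  (∃ λ (S : Subset n) → MinimalDominating G S × ∣ S ∣ ≡ m)
  × (∀ (S : Subset n) → MinimalDominating G S → ∣ S ∣ ≤ m)

_△_ : ∀ {n} → Subset n → Subset n → Subset n
A △ B = (A ─ B) ∪ (B ─ A)

DkVertex : ∀ {n} → Graph n → ℕ → Subset n → Set
DkVertex G k S = Dominating G S × ∣ S ∣ ≤ k

DkAdj : ∀ {n} → Subset n → Subset n → Set
DkAdj {n} A B = ∃ λ (v : Fin n) → A △ B ≡ ⁅ v ⁆

data DkWalk {n} (G : Graph n) (k : ℕ) : Subset n → Subset n → Set where
  here : ∀ {A} → DkVertex G k A → DkWalk G k A A
  step : ∀ {A B C} → DkVertex G k A → DkAdj A B → DkWalk G k B C → DkWalk G k A C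

DkConnected : ∀ {n} → Graph n → ℕ → Set
DkConnected {n} G k =
  ∀ (A B : Subset n) → DkVertex G k A → DkVertex G k B → DkWalk G k A B

module Submission where

-- Colour G properly white/black and call a vertex active if it is black and has a
-- neighbour.  The inactive vertices (all white vertices and all isolated ones) form a
-- dominating set, the target, and we join every vertex A of D_{Γ+1}(G) to it; two walks
-- to the target give connectivity.  From A we first delete vertices down to a locally
-- minimal dominating subset M.  If M has an active member y, an exchange step adds white
-- vertices (the external private neighbours of y, or a single neighbour of y if there are
-- none) and then deletes y.  The intermediate set has at most Γ+1 vertices: the key bound
-- injects it, minus y, into an independent set, and independent sets extend to minimal
-- dominating sets.  Each step lowers the number of active members, so induction on that
-- number reaches the target.

open import Defs hiding (sym)
open import Data.Nat using (ℕ; suc; _≤_; _<_; _+_; z≤n; s≤s)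
open import Data.Nat.Properties using (≤-trans; ≤-<-trans; <-≤-trans; +-comm; module ≤-Reasoning)
open import Data.Nat.Induction using (<-wellFounded)
open import Data.Fin using (Fin; _≟_)
open import Data.Fin.Subset
open import Data.Fin.Subset.Properties
open import Data.Fin.Subset.Induction using (⊂-wellFounded; ⊃-wellFounded)
open import Data.Fin.Properties using (any?; all?)
open import Data.Bool using (Bool; true; false; not)
import Data.Bool as Bool
open import Data.Bool.Properties using (¬-not)
open import Data.Vec using ([]; _∷_; tabulate; here; there)
open import Data.Vec.Properties using ([]=⇒lookup; lookup⇒[]=; lookup∘tabulate)
open import Data.Product using (∃; _×_; _,_; proj₁; proj₂)
open import Data.Sum using (_⊎_; inj₁; inj₂)
open import Data.Empty using (⊥-elim)
open import Induction.WellFounded using (Acc; acc)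
open import Relation.Nullary using (¬_; Dec; yes; no; does; ¬?)
open import Relation.Nullary.Decidable using (_×-dec_; _⊎-dec_; _→-dec_; dec-true)
open import Relation.Unary using (Decidable)
open import Relation.Binary.PropositionalEquality using (_≡_; _≢_; refl; sym; trans; subst; subst₂; cong)

subsetOf : ∀ {n} {P : Fin n → Set} → Decidable P → Subset n
subsetOf P? = tabulate (λ x → does (P? x))

∈-subsetOf⁺ : ∀ {n} {P : Fin n → Set} (P? : Decidable P) {x} → P x → x ∈ subsetOf P?
∈-subsetOf⁺ P? {x} px = lookup⇒[]= x _ (trans (lookup∘tabulate _ x) (dec-true (P? x) px))

∈-subsetOf⁻ : ∀ {n} {P : Fin n → Set} (P? : Decidable P) {x} → x ∈ subsetOf P? → P x
∈-subsetOf⁻ P? {x} x∈ with P? x | trans (sym (lookup∘tabulate (λ y → does (P? y)) x)) ([]=⇒lookup x∈)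
... | yes px | _  = px
... | no  _  | ()

x∈p-y⁻ : ∀ {n} {p : Subset n} {x y} → x ∈ p - y → x ∈ p × x ≢ y
x∈p-y⁻ {p = p} {y = y} x∈ = p─q⊆p p ⁅ y ⁆ x∈ , x∉⁅y⁆⇒x≢y (x∉q p ⁅ y ⁆ x∈)
  where
  x∉q : ∀ {n} (p q : Subset n) {x} → x ∈ p ─ q → x ∉ q
  x∉q (true ∷ p) (false ∷ q) here ()
  x∉q (_ ∷ p) (_ ∷ q) (there x∈) (there x∈q) = x∉q p q x∈ x∈q

∈-∪⁅⁆⁻ : ∀ {n} {p : Subset n} {x v} → x ∈ p ∪ ⁅ v ⁆ → x ∈ p ⊎ x ≡ v
∈-∪⁅⁆⁻ {p = p} {v = v} x∈ with x∈p∪q⁻ p ⁅ v ⁆ x∈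
... | inj₁ x∈p = inj₁ x∈p
... | inj₂ x∈v = inj₂ (x∈⁅y⁆⇒x≡y v x∈v)

∣p∣≡1+∣p-x∣ : ∀ {n} (p : Subset n) {x} → x ∈ p → ∣ p ∣ ≡ suc ∣ p - x ∣
∣p∣≡1+∣p-x∣ (true ∷ p)  here      = cong (λ q → suc ∣ q ∣) (sym (p─⊥≡p p))
∣p∣≡1+∣p-x∣ (true ∷ p)  (there i) = cong suc (∣p∣≡1+∣p-x∣ p i)
∣p∣≡1+∣p-x∣ (false ∷ p) (there i) = ∣p∣≡1+∣p-x∣ p i

p△p≡⊥ : ∀ {n} (p : Subset n) → p △ p ≡ ⊥
p△p≡⊥ []          = refl
p△p≡⊥ (true ∷ p)  = cong (false ∷_) (p△p≡⊥ p)
p△p≡⊥ (false ∷ p) = cong (false ∷_) (p△p≡⊥ p)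

p△p-x≡⁅x⁆ : ∀ {n} (p : Subset n) {x} → x ∈ p → p △ (p - x) ≡ ⁅ x ⁆
p△p-x≡⁅x⁆ (true ∷ p)  here      = cong (true ∷_) (trans (cong (p △_) (p─⊥≡p p)) (p△p≡⊥ p))
p△p-x≡⁅x⁆ (true ∷ p)  (there i) = cong (false ∷_) (p△p-x≡⁅x⁆ p i)
p△p-x≡⁅x⁆ (false ∷ p) (there i) = cong (false ∷_) (p△p-x≡⁅x⁆ p i)

deletion-adj : ∀ {n} {S : Subset n} {x} → x ∈ S → DkAdj S (S - x)
deletion-adj {S = S} {x} x∈S = x , p△p-x≡⁅x⁆ S x∈S

DkAdj-sym : ∀ {n} {A B : Subset n} → DkAdj A B → DkAdj B A
DkAdj-sym {A = A} {B} (v , e) = v , trans (∪-comm (B ─ A) (A ─ B)) e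

-- By well-founded recursion on A: match one x with its w and recurse on A - x, B - w.
injection-≤ : ∀ {n} (R : Fin n → Fin n → Set) (A B : Subset n) →
  (∀ {x} → x ∈ A → ∃ λ w → w ∈ B × R x w) →
  (∀ {x x′ w} → x ∈ A → x′ ∈ A → R x w → R x′ w → x ≡ x′) → ∣ A ∣ ≤ ∣ B ∣
injection-≤ {n} R A₀ B₀ = go A₀ (⊂-wellFounded A₀) B₀
  where
  go : ∀ A → Acc _⊂_ A → ∀ B → (∀ {x} → x ∈ A → ∃ λ w → w ∈ B × R x w) →
    (∀ {x x′ w} → x ∈ A → x′ ∈ A → R x w → R x′ w → x ≡ x′) → ∣ A ∣ ≤ ∣ B ∣
  go A (acc rec) B total unique with nonempty? A
  ... | no A-empty = subst (_≤ ∣ B ∣) (sym (trans (cong ∣_∣ (Empty-unique A-empty)) (∣⊥∣≡0 n))) z≤n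
  ... | yes (x , x∈A) with total x∈A
  ...   | w , w∈B , xRw =
    subst₂ _≤_ (sym (∣p∣≡1+∣p-x∣ A x∈A)) (sym (∣p∣≡1+∣p-x∣ B w∈B))
      (s≤s (go (A - x) (rec (x∈p⇒p-x⊂p x∈A)) (B - w) total′ unique′))
    where
    total′ : ∀ {x′} → x′ ∈ A - x → ∃ λ w′ → w′ ∈ B - w × R x′ w′
    total′ x′∈ with x∈p-y⁻ x′∈ | total (proj₁ (x∈p-y⁻ x′∈))
    ... | x′∈A , x′≢x | w′ , w′∈B , x′Rw′ =
      w′ , x∈p∧x≢y⇒x∈p-y w′∈B (λ { refl → x′≢x (unique x′∈A x∈A x′Rw′ xRw) }) , x′Rw′
    unique′ : ∀ {x₁ x₂ w′} → x₁ ∈ A - x → x₂ ∈ A - x → R x₁ w′ → R x₂ w′ → x₁ ≡ x₂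
    unique′ x₁∈ x₂∈ = unique (proj₁ (x∈p-y⁻ x₁∈)) (proj₁ (x∈p-y⁻ x₂∈))

module Domination {n} (G : Graph n) where

  NeighbourIn : Subset n → Fin n → Set
  NeighbourIn X v = ∃ λ u → u ∈ X × Adj G v u

  neighbourIn? : ∀ X → Decidable (NeighbourIn X)
  neighbourIn? X v = any? (λ u → (u ∈? X) ×-dec adj? G v u)

  Undominated : Subset n → Fin n → Set
  Undominated X w = w ∉ X × ¬ NeighbourIn X w

  undominated? : ∀ X → Decidable (Undominated X)
  undominated? X w = ¬? (w ∈? X) ×-dec ¬? (neighbourIn? X w)

  dominating-or-undominated : ∀ X → Dominating G X ⊎ ∃ (Undominated X)
  dominating-or-undominated X with any? (undominated? X)
  ... | yes w = inj₂ w
  ... | no none = inj₁ dominates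
    where
    dominates : Dominating G X
    dominates v v∉X with neighbourIn? X v
    ... | yes u = u
    ... | no ¬u = ⊥-elim (none (v , v∉X , ¬u))

  dominating? : Decidable (Dominating G)
  dominating? X with dominating-or-undominated X
  ... | inj₁ d = yes d
  ... | inj₂ (w , w∉X , ¬u) = no λ d → ¬u (d w w∉X)

  dominating-⊆ : ∀ {X Y} → Dominating G X → X ⊆ Y → Dominating G Y
  dominating-⊆ d X⊆Y v v∉Y with d v (λ v∈X → v∉Y (X⊆Y v∈X))
  ... | u , u∈X , adj = u , X⊆Y u∈X , adj

  -- For x ∈ S, a vertex undominated by S - x is a private
  -- neighbour of x (in the closed-neighbourhood sense): it is x itself or adjacent to x,
  -- and it determines x uniquely.
  private-neighbour : ∀ {S x w} → Dominating G S → Undominated (S - x) w → w ≡ x ⊎ Adj G w x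
  private-neighbour {S} {x} {w} dS (w∉ , ¬nb) with w ≟ x
  ... | yes w≡x = inj₁ w≡x
  ... | no w≢x with w ∈? S
  ...   | yes w∈S = ⊥-elim (w∉ (x∈p∧x≢y⇒x∈p-y w∈S w≢x))
  ...   | no w∉S with dS w w∉S
  ...     | u , u∈S , adj with u ≟ x
  ...       | yes refl = inj₂ adj
  ...       | no u≢x = ⊥-elim (¬nb (u , x∈p∧x≢y⇒x∈p-y u∈S u≢x , adj))

  private-unique : ∀ {S x x′ w} → Dominating G S → x′ ∈ S →
    Undominated (S - x) w → Undominated (S - x′) w → x ≡ x′
  private-unique {S} {x} {x′} {w} dS x′∈S (w∉ , ¬nb) priv′ with x ≟ x′
  ... | yes x≡x′ = x≡x′
  ... | no x≢x′ = ⊥-elim (excluded (private-neighbour dS priv′))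
    where
    x′∈S-x : x′ ∈ S - x
    x′∈S-x = x∈p∧x≢y⇒x∈p-y x′∈S (λ e → x≢x′ (sym e))
    excluded : ¬ (w ≡ x′ ⊎ Adj G w x′)
    excluded (inj₁ refl) = w∉ x′∈S-x
    excluded (inj₂ adj)  = ¬nb (x′ , x′∈S-x , adj)

  LocallyMinimal : Subset n → Set
  LocallyMinimal X = ∀ {v} → v ∈ X → ¬ Dominating G (X - v)

  -- Domination is upward closed, so local minimality is minimality.
  locallyMinimal⇒minimal : ∀ {X} → Dominating G X → LocallyMinimal X → MinimalDominating G X
  locallyMinimal⇒minimal {X} dX lm = dX , λ where
    T (T⊆X , x , x∈X , x∉T) dT → lm x∈X (dominating-⊆ dT (λ {y} y∈T →
      x∈p∧x≢y⇒x∈p-y (T⊆X y∈T) (λ { refl → x∉T y∈T })))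

  private-exists : ∀ {S x} → LocallyMinimal S → x ∈ S → ∃ (Undominated (S - x))
  private-exists {S} {x} lm x∈S with dominating-or-undominated (S - x)
  ... | inj₁ d = ⊥-elim (lm x∈S d)
  ... | inj₂ w = w

  minimal-subset : ∀ X → Dominating G X → ∃ λ M → M ⊆ X × Dominating G M × LocallyMinimal M
  minimal-subset X₀ = go X₀ (⊂-wellFounded X₀)
    where
    go : ∀ X → Acc _⊂_ X → Dominating G X → ∃ λ M → M ⊆ X × Dominating G M × LocallyMinimal M
    go X (acc rec) dX with any? (λ v → (v ∈? X) ×-dec dominating? (X - v))
    ... | no none = X , (λ x∈X → x∈X) , dX , λ v∈X d → none (_ , v∈X , d)
    ... | yes (v , v∈X , d) with go (X - v) (rec (x∈p⇒p-x⊂p v∈X)) d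
    ...   | M , M⊆X-v , rest = M , (λ x∈M → p─q⊆p X ⁅ v ⁆ (M⊆X-v x∈M)) , rest

  Independent : Subset n → Set
  Independent X = ∀ {a b} → a ∈ X → b ∈ X → ¬ Adj G a b

  -- A dominating independent set is minimal: dropping a vertex leaves it undominated.
  independent⇒minimal : ∀ {X} → Independent X → Dominating G X → MinimalDominating G X
  independent⇒minimal ind dX = dX , λ where
    T (T⊆X , x , x∈X , x∉T) dT → let (u , u∈T , adj) = dT x x∉T in ind x∈X (T⊆X u∈T) adj

  independent-∪ : ∀ {I v} → Independent I → Undominated I v → Independent (I ∪ ⁅ v ⁆)
  independent-∪ ind (_ , ¬nb) a∈ b∈ adj with ∈-∪⁅⁆⁻ a∈ | ∈-∪⁅⁆⁻ b∈
  ... | inj₁ a∈I  | inj₁ b∈I  = ind a∈I b∈I adj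
  ... | inj₁ a∈I  | inj₂ refl = ¬nb (_ , a∈I , Graph.sym G adj)
  ... | inj₂ refl | inj₁ b∈I  = ¬nb (_ , b∈I , adj)
  ... | inj₂ refl | inj₂ refl = Graph.irrefl G adj

  -- Every independent set lies in a minimal dominating set: enlarge it by
  -- undominated vertices until it is a maximal independent set.
  independent⊆minimal : ∀ I → Independent I → ∃ λ M → I ⊆ M × MinimalDominating G M
  independent⊆minimal I₀ = go I₀ (⊃-wellFounded I₀)
    where
    go : ∀ I → Acc _⊃_ I → Independent I → ∃ λ M → I ⊆ M × MinimalDominating G M
    go I (acc rec) ind with dominating-or-undominated I
    ... | inj₁ dI = I , (λ x∈I → x∈I) , independent⇒minimal ind dI
    ... | inj₂ (v , undom@(v∉I , _))
      with go (I ∪ ⁅ v ⁆) (rec (p⊆p∪q ⁅ v ⁆ , v , x∈p∪q⁺ (inj₂ (x∈⁅x⁆ v)) , v∉I))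
              (independent-∪ ind undom)
    ...   | M , I+v⊆M , minM = M , (λ x∈I → I+v⊆M (p⊆p∪q ⁅ v ⁆ x∈I)) , minM

  ExternalPrivate : Subset n → Fin n → Fin n → Set
  ExternalPrivate S y v = v ∉ S × Adj G v y × (∀ u → u ∈ S → Adj G v u → u ≡ y)

  externalPrivate? : ∀ S y → Decidable (ExternalPrivate S y)
  externalPrivate? S y v = ¬? (v ∈? S) ×-dec adj? G v y ×-dec
    all? (λ u → (u ∈? S) →-dec (adj? G v u →-dec (u ≟ y)))

  exchange-dominates : ∀ {S U y} → Dominating G S → S ⊆ U →
    (∀ {v} → ExternalPrivate S y v → v ∈ U) → NeighbourIn U y → Dominating G (U - y)
  exchange-dominates {S} {U} {y} dS S⊆U privates⊆U (p , p∈U , y~p) v v∉U-y with v ≟ y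
  ... | yes refl = p , x∈p∧x≢y⇒x∈p-y p∈U (λ { refl → Graph.irrefl G y~p }) , y~p
  ... | no v≢y with neighbourIn? (S - y) v
  ...   | yes (u , u∈S-y , adj) =
    u , x∈p∧x≢y⇒x∈p-y (S⊆U (proj₁ (x∈p-y⁻ u∈S-y))) (proj₂ (x∈p-y⁻ u∈S-y)) , adj
  ...   | no ¬nb = ⊥-elim (v∉U (privates⊆U (v∉S , v~y , only-y)))
    where
    v∉U : v ∉ U
    v∉U v∈U = v∉U-y (x∈p∧x≢y⇒x∈p-y v∈U v≢y)
    v∉S : v ∉ S
    v∉S v∈S = v∉U (S⊆U v∈S)
    only-y : ∀ u → u ∈ S → Adj G v u → u ≡ y
    only-y u u∈S adj with u ≟ y
    ... | yes u≡y = u≡y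
    ... | no u≢y = ⊥-elim (¬nb (u , x∈p∧x≢y⇒x∈p-y u∈S u≢y , adj))
    v~y : Adj G v y
    v~y = let (u , u∈S , adj) = dS v v∉S in subst (Adj G v) (only-y u u∈S adj) adj

module Walks {n} {G : Graph n} {k : ℕ} where
  open Domination G using (dominating-⊆)

  start : ∀ {A B} → DkWalk G k A B → DkVertex G k A
  start (here vA)     = vA
  start (step vA _ _) = vA

  _++_ : ∀ {A B C} → DkWalk G k A B → DkWalk G k B C → DkWalk G k A C
  here _        ++ w′ = w′
  step vA adj w ++ w′ = step vA adj (w ++ w′)

  reverse : ∀ {A B} → DkWalk G k A B → DkWalk G k B A
  reverse (here vA)       = here vA
  reverse (step vA adj w) = reverse w ++ step (start w) (DkAdj-sym adj) (here vA)

  -- If Z ⊆ U, Z dominates and |U| ≤ k, deleting the vertices of U ∖ Z one at a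
  -- time is a walk from U to Z: every intermediate set contains Z and is no larger than U.
  descend : ∀ {Z} U → Dominating G Z → Z ⊆ U → ∣ U ∣ ≤ k → DkWalk G k U Z
  descend {Z} U₀ dZ = go U₀ (⊂-wellFounded U₀)
    where
    go : ∀ U → Acc _⊂_ U → Z ⊆ U → ∣ U ∣ ≤ k → DkWalk G k U Z
    go U (acc rec) Z⊆U ∣U∣≤k with any? (λ x → (x ∈? U) ×-dec ¬? (x ∈? Z))
    ... | no none = subst (DkWalk G k U) (⊆-antisym U⊆Z Z⊆U) (here vU)
      where
      vU : DkVertex G k U
      vU = dominating-⊆ dZ Z⊆U , ∣U∣≤k
      U⊆Z : U ⊆ Z
      U⊆Z {x} x∈U with x ∈? Z
      ... | yes x∈Z = x∈Z
      ... | no x∉Z = ⊥-elim (none (x , x∈U , x∉Z))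
    ... | yes (x , x∈U , x∉Z) =
      step (dominating-⊆ dZ Z⊆U , ∣U∣≤k) (deletion-adj x∈U)
        (go (U - x) (rec (x∈p⇒p-x⊂p x∈U)) Z⊆U-x (≤-trans (∣p─q∣≤∣p∣ U ⁅ x ⁆) ∣U∣≤k))
      where
      Z⊆U-x : Z ⊆ U - x
      Z⊆U-x z∈Z = x∈p∧x≢y⇒x∈p-y (Z⊆U z∈Z) (λ { refl → x∉Z z∈Z })

-- The bipartite setting: c is a proper 2-colouring (true = white, false = black)
-- and every minimal dominating set has at most m vertices.
module Reconfiguration {n} (G : Graph n) (c : Fin n → Bool)
  (proper : ∀ u v → Adj G u v → c u ≢ c v)
  (m : ℕ) (Γ-bound : ∀ S → MinimalDominating G S → ∣ S ∣ ≤ m) where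
  open Domination G
  open Walks {G = G} {k = m + 1}

  adj-flip : ∀ {u v b} → Adj G u v → c v ≡ b → c u ≡ not b
  adj-flip {u} {v} adj refl = ¬-not (proper u v adj)

  same-colour⇒¬adj : ∀ {u v} → c u ≡ c v → ¬ Adj G u v
  same-colour⇒¬adj {u} {v} same adj = proper u v adj same

  white≢black : ∀ {a b} → c a ≡ true → c b ≡ false → a ≢ b
  white≢black ca cb refl with trans (sym ca) cb
  ... | ()

  -- Let S be a locally minimal dominating set, y ∈ S black, and P the
  -- external private neighbours of y.  Then A = (S ∪ P) - y has at most m vertices:
  -- A injects into an independent set I (white vertices of A and white private
  -- neighbours of S, plus the black members of S - y without white private neighbour),
  -- and I extends to a minimal dominating set.
  module ExchangeBound {S} (dS : Dominating G S) (lmS : LocallyMinimal S)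
    {y} (y∈S : y ∈ S) (cy : c y ≡ false) where

    P : Subset n
    P = subsetOf (externalPrivate? S y)

    A : Subset n
    A = (S ∪ P) - y

    A-member : ∀ {x} → x ∈ A → x ≢ y × (x ∈ S ⊎ ExternalPrivate S y x)
    A-member x∈A with x∈p-y⁻ x∈A
    ... | x∈S∪P , x≢y with x∈p∪q⁻ S P x∈S∪P
    ...   | inj₁ x∈S = x≢y , inj₁ x∈S
    ...   | inj₂ x∈P = x≢y , inj₂ (∈-subsetOf⁻ (externalPrivate? S y) x∈P)

    -- External private neighbours of the black y are white, so black members of A lie in S.
    black∈A⇒∈S : ∀ {x} → x ∈ A → c x ≡ false → x ∈ S
    black∈A⇒∈S x∈A cx with A-member x∈A
    ... | _ , inj₁ x∈S = x∈S
    ... | _ , inj₂ (_ , x~y , _) with trans (sym (adj-flip x~y cy)) cx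
    ...   | ()

    WhitePrivate : Fin n → Fin n → Set
    WhitePrivate x w = Undominated (S - x) w × c w ≡ true

    whitePrivate? : ∀ x → Dec (∃ (WhitePrivate x))
    whitePrivate? x = any? (λ w → undominated? (S - x) w ×-dec (c w Bool.≟ true))

    self-private : ∀ {x} → x ∈ S → c x ≡ false → ¬ ∃ (WhitePrivate x) → Undominated (S - x) x
    self-private x∈S cx none with private-exists lmS x∈S
    ... | w , priv with private-neighbour dS priv
    ...   | inj₁ refl = priv
    ...   | inj₂ w~x = ⊥-elim (none (w , priv , adj-flip w~x cx))

    WhiteMember : Fin n → Set
    WhiteMember v = c v ≡ true × (v ∈ A ⊎ ∃ λ x → x ∈ S × Undominated (S - x) v)

    BlackMember : Fin n → Set
    BlackMember v = v ∈ S × c v ≡ false × v ≢ y × ¬ ∃ (WhitePrivate v)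

    member? : Decidable (λ v → WhiteMember v ⊎ BlackMember v)
    member? v =
      ((c v Bool.≟ true) ×-dec ((v ∈? A) ⊎-dec any? (λ x → (x ∈? S) ×-dec undominated? (S - x) v)))
      ⊎-dec ((v ∈? S) ×-dec (c v Bool.≟ false) ×-dec ¬? (v ≟ y) ×-dec ¬? (whitePrivate? v))

    I : Subset n
    I = subsetOf member?

    -- A white and a black member of I are never adjacent; the colour classes are
    -- independent by bipartiteness, so I is independent.
    white-black-¬adj : ∀ {a b} → WhiteMember a → BlackMember b → ¬ Adj G a b
    white-black-¬adj {a} {b} (ca , inj₁ a∈A) (b∈S , cb , b≢y , none) adj with A-member a∈A
    ... | _ , inj₁ a∈S =
      proj₂ (self-private b∈S cb none)
        (a , x∈p∧x≢y⇒x∈p-y a∈S (white≢black ca cb) , Graph.sym G adj)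
    ... | _ , inj₂ (_ , _ , only) = b≢y (only b b∈S adj)
    white-black-¬adj {a} {b} (ca , inj₂ (x , x∈S , priv)) (b∈S , cb , b≢y , none) adj with b ≟ x
    ... | yes refl = none (a , priv , ca)
    ... | no b≢x = proj₂ priv (b , x∈p∧x≢y⇒x∈p-y b∈S b≢x , adj)

    I-independent : Independent I
    I-independent a∈I b∈I adj with ∈-subsetOf⁻ member? a∈I | ∈-subsetOf⁻ member? b∈I
    ... | inj₁ (ca , _)     | inj₁ (cb , _)     = same-colour⇒¬adj (trans ca (sym cb)) adj
    ... | inj₂ (_ , ca , _) | inj₂ (_ , cb , _) = same-colour⇒¬adj (trans ca (sym cb)) adj
    ... | inj₁ wa           | inj₂ bb           = white-black-¬adj wa bb adj
    ... | inj₂ ba           | inj₁ wb           = white-black-¬adj wb ba (Graph.sym G adj)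

    Matched : Fin n → Fin n → Set
    Matched x w = (c x ≡ true × w ≡ x) ⊎ (c x ≡ false × Undominated (S - x) w)

    matched-total : ∀ {x} → x ∈ A → ∃ λ w → w ∈ I × Matched x w
    matched-total {x} x∈A with c x in cx
    ... | true = x , ∈-subsetOf⁺ member? (inj₁ (cx , inj₁ x∈A)) , inj₁ (refl , refl)
    ... | false with whitePrivate? x
    ...   | yes (w , priv , cw) =
      w , ∈-subsetOf⁺ member? (inj₁ (cw , inj₂ (x , black∈A⇒∈S x∈A cx , priv))) , inj₂ (refl , priv)
    ...   | no none =
      x , ∈-subsetOf⁺ member? (inj₂ (x∈S , cx , proj₁ (A-member x∈A) , none)) ,
      inj₂ (refl , self-private x∈S cx none)
      where x∈S = black∈A⇒∈S x∈A cx

    white-not-private : ∀ {x x′} → x ∈ A → c x ≡ true → x′ ∈ A → c x′ ≡ false →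
      ¬ Undominated (S - x′) x
    white-not-private x∈A cx x′∈A cx′ priv with A-member x∈A
    ... | _ , inj₁ x∈S = proj₁ priv (x∈p∧x≢y⇒x∈p-y x∈S (white≢black cx cx′))
    ... | _ , inj₂ (_ , _ , only) with private-neighbour dS priv
    ...   | inj₁ x≡x′ = white≢black cx cx′ x≡x′
    ...   | inj₂ x~x′ = proj₁ (A-member x′∈A) (only _ (black∈A⇒∈S x′∈A cx′) x~x′)

    matched-unique : ∀ {x x′ w} → x ∈ A → x′ ∈ A → Matched x w → Matched x′ w → x ≡ x′
    matched-unique _   _    (inj₁ (_ , refl))  (inj₁ (_ , refl))    = refl
    matched-unique x∈A x′∈A (inj₁ (cx , refl)) (inj₂ (cx′ , priv′)) =
      ⊥-elim (white-not-private x∈A cx x′∈A cx′ priv′)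
    matched-unique x∈A x′∈A (inj₂ (cx , priv)) (inj₁ (cx′ , refl))  =
      ⊥-elim (white-not-private x′∈A cx′ x∈A cx priv)
    matched-unique _   x′∈A (inj₂ (_ , priv))  (inj₂ (cx′ , priv′)) =
      private-unique dS (black∈A⇒∈S x′∈A cx′) priv priv′

    ∣A∣≤m : ∣ A ∣ ≤ m
    ∣A∣≤m with independent⊆minimal I I-independent
    ... | M , I⊆M , minM = begin
      ∣ A ∣ ≤⟨ injection-≤ Matched A I matched-total matched-unique ⟩
      ∣ I ∣ ≤⟨ p⊆q⇒∣p∣≤∣q∣ I⊆M ⟩
      ∣ M ∣ ≤⟨ Γ-bound M minM ⟩
      m     ∎
      where open ≤-Reasoning

  Active : Fin n → Set
  Active v = c v ≡ false × ∃ (Adj G v)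

  active? : Decidable Active
  active? v = (c v Bool.≟ false) ×-dec any? (adj? G v)

  active : Subset n
  active = subsetOf active?

  target : Subset n
  target = ∁ active

  inactive⇒target : ∀ {S} → Dominating G S → (∀ {v} → v ∈ S → ¬ Active v) → S ≡ target
  inactive⇒target {S} dS inactive = ⊆-antisym S⊆target target⊆S
    where
    S⊆target : S ⊆ target
    S⊆target v∈S = x∉p⇒x∈∁p (λ v∈act → inactive v∈S (∈-subsetOf⁻ active? v∈act))
    target⊆S : target ⊆ S
    target⊆S {v} v∈target with v ∈? S
    ... | yes v∈S = v∈S
    ... | no v∉S with dS v v∉S | c v in cv
    ...   | u , u∈S , v~u | false = ⊥-elim (x∈∁p⇒x∉p v∈target (∈-subsetOf⁺ active? (cv , u , v~u)))
    ...   | u , u∈S , v~u | true  =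
      ⊥-elim (inactive u∈S (adj-flip (Graph.sym G v~u) cv , v , Graph.sym G v~u))

  ∣U∣≤m+1 : ∀ {U : Subset n} {y} → y ∈ U → ∣ U - y ∣ ≤ m → ∣ U ∣ ≤ m + 1
  ∣U∣≤m+1 {U} {y} y∈U ∣U-y∣≤m = begin
    ∣ U ∣          ≡⟨ ∣p∣≡1+∣p-x∣ U y∈U ⟩
    suc ∣ U - y ∣  ≤⟨ s≤s ∣U-y∣≤m ⟩
    suc m          ≡⟨ +-comm 1 m ⟩
    m + 1          ∎
    where open ≤-Reasoning

  Exchange : Subset n → Set
  Exchange S = ∃ λ W →
    DkVertex G (m + 1) W × ∣ W ∩ active ∣ < ∣ S ∩ active ∣ × DkWalk G (m + 1) S W

  exchange-through : ∀ {S U y} → Dominating G S → S ⊆ U → ∣ U ∣ ≤ m + 1 →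
    Dominating G (U - y) → (∀ {x} → x ∈ U → x ∉ S → c x ≡ true) → y ∈ S → Active y → Exchange S
  exchange-through {S} {U} {y} dS S⊆U ∣U∣≤ dW new-white y∈S act =
    U - y , (dW , ≤-trans (∣p─q∣≤∣p∣ U ⁅ y ⁆) ∣U∣≤) , fewer ,
    reverse (descend U dS S⊆U ∣U∣≤) ++
      step (dominating-⊆ dS S⊆U , ∣U∣≤) (deletion-adj (S⊆U y∈S))
        (here (dW , ≤-trans (∣p─q∣≤∣p∣ U ⁅ y ⁆) ∣U∣≤))
    where
    shrinks : (U - y) ∩ active ⊆ (S ∩ active) - y
    shrinks {x} x∈ with x∈p∩q⁻ (U - y) active x∈
    ... | x∈U-y , x∈act with x∈p-y⁻ x∈U-y | x ∈? S
    ...   | _ , x≢y | yes x∈S = x∈p∧x≢y⇒x∈p-y (x∈p∩q⁺ (x∈S , x∈act)) x≢y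
    ...   | x∈U , _ | no x∉S
      with trans (sym (new-white x∈U x∉S)) (proj₁ (∈-subsetOf⁻ active? x∈act))
    ...     | ()
    fewer : ∣ (U - y) ∩ active ∣ < ∣ S ∩ active ∣
    fewer = ≤-<-trans (p⊆q⇒∣p∣≤∣q∣ shrinks)
      (x∈p⇒∣p-x∣<∣p∣ (x∈p∩q⁺ (y∈S , ∈-subsetOf⁺ active? act)))

  module ExchangeStep {S} (dS : Dominating G S) (lmS : LocallyMinimal S)
    {y} (y∈S : y ∈ S) (act : Active y) where
    open ExchangeBound dS lmS y∈S (proj₁ act) using (P; ∣A∣≤m)

    -- If y has an external private neighbour, add all of them (|(S ∪ P) - y| ≤ m).
    via-privates : Nonempty P → Exchange S
    via-privates (p , p∈P) =
      exchange-through dS S⊆U (∣U∣≤m+1 (S⊆U y∈S) ∣A∣≤m)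
        (exchange-dominates dS S⊆U (λ priv → q⊆p∪q S P (∈-subsetOf⁺ (externalPrivate? S y) priv))
          (p , q⊆p∪q S P p∈P , Graph.sym G (proj₁ (proj₂ (private-of p∈P)))))
        new-white y∈S act
      where
      S⊆U : S ⊆ S ∪ P
      S⊆U = p⊆p∪q P
      private-of : ∀ {x} → x ∈ P → ExternalPrivate S y x
      private-of = ∈-subsetOf⁻ (externalPrivate? S y)
      new-white : ∀ {x} → x ∈ S ∪ P → x ∉ S → c x ≡ true
      new-white {x} x∈ x∉S with x∈p∪q⁻ S P x∈
      ... | inj₁ x∈S = ⊥-elim (x∉S x∈S)
      ... | inj₂ x∈P = adj-flip (proj₁ (proj₂ (private-of x∈P))) (proj₁ act)

    -- Otherwise add a single neighbour z of y (|S ∪ ⁅ z ⁆| ≤ |S| + 1 ≤ m + 1).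
    via-neighbour : Empty P → Exchange S
    via-neighbour no-private =
      exchange-through dS S⊆U (∣U∣≤m+1 z∈U ∣U-z∣≤m)
        (exchange-dominates dS S⊆U
          (λ priv → ⊥-elim (no-private (_ , ∈-subsetOf⁺ (externalPrivate? S y) priv)))
          (z , z∈U , y~z))
        new-white y∈S act
      where
      z = proj₁ (proj₂ act)
      y~z = proj₂ (proj₂ act)
      S⊆U : S ⊆ S ∪ ⁅ z ⁆
      S⊆U = p⊆p∪q ⁅ z ⁆
      z∈U : z ∈ S ∪ ⁅ z ⁆
      z∈U = q⊆p∪q S ⁅ z ⁆ (x∈⁅x⁆ z)
      U-z⊆S : (S ∪ ⁅ z ⁆) - z ⊆ S
      U-z⊆S x∈ with x∈p-y⁻ x∈
      ... | x∈U , x≢z with ∈-∪⁅⁆⁻ x∈U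
      ...   | inj₁ x∈S = x∈S
      ...   | inj₂ x≡z = ⊥-elim (x≢z x≡z)
      ∣U-z∣≤m : ∣ (S ∪ ⁅ z ⁆) - z ∣ ≤ m
      ∣U-z∣≤m = ≤-trans (p⊆q⇒∣p∣≤∣q∣ U-z⊆S) (Γ-bound S (locallyMinimal⇒minimal dS lmS))
      new-white : ∀ {x} → x ∈ S ∪ ⁅ z ⁆ → x ∉ S → c x ≡ true
      new-white x∈ x∉S with ∈-∪⁅⁆⁻ x∈
      ... | inj₁ x∈S = ⊥-elim (x∉S x∈S)
      ... | inj₂ refl = adj-flip (Graph.sym G y~z) (proj₁ act)

    exchange : Exchange S
    exchange with nonempty? P
    ... | yes nonempty = via-privates nonempty
    ... | no empty = via-neighbour empty

  reaches-target : ∀ {A} → DkVertex G (m + 1) A → DkWalk G (m + 1) A target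
  reaches-target {A₀} = go A₀ (<-wellFounded ∣ A₀ ∩ active ∣)
    where
    go : ∀ A → Acc _<_ ∣ A ∩ active ∣ → DkVertex G (m + 1) A → DkWalk G (m + 1) A target
    go A (acc rec) (dA , ∣A∣≤) with minimal-subset A dA
    ... | M , M⊆A , dM , lmM = descend A dM M⊆A ∣A∣≤ ++ from-M
      where
      M-active≤A-active : ∣ M ∩ active ∣ ≤ ∣ A ∩ active ∣
      M-active≤A-active = p⊆q⇒∣p∣≤∣q∣ λ x∈ →
        let (x∈M , x∈act) = x∈p∩q⁻ M active x∈ in x∈p∩q⁺ (M⊆A x∈M , x∈act)
      from-M : DkWalk G (m + 1) M target
      from-M with any? (λ v → (v ∈? M) ×-dec active? v)
      ... | no none = subst (DkWalk G (m + 1) M)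
        (inactive⇒target dM λ v∈M act → none (_ , v∈M , act))
        (here (dM , ≤-trans (p⊆q⇒∣p∣≤∣q∣ M⊆A) ∣A∣≤))
      ... | yes (y , y∈M , act) with ExchangeStep.exchange dM lmM y∈M act
      ...   | W , vW , fewer , M→W = M→W ++ go W (rec (<-≤-trans fewer M-active≤A-active)) vW

  connected : DkConnected G (m + 1)
  connected A B vA vB = reaches-target vA ++ reverse (reaches-target vB)

-- Theorem 7.
theorem7 : ∀ (n : ℕ) (G : Graph n) → 2 ≤ n → Bipartite G →
    ∀ (m : ℕ) → IsUpperDomination G m → DkConnected G (m + 1)
theorem7 n G _ (c , proper) m (_ , Γ-bound) = Reconfiguration.connected G c proper m Γ-bound
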